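{- For every integer $n\ge 1$, $noc(K_{1,n-1})=2^{n-1}+n$, where $K_{1,n-1}$ is the star on $n$ vertices.
   Context: For a finite simple undirected graph $G=(V,E)$, a set $S\subseteq V$ is called $P_3$-convex if for every path $x$--$z$--$y$ in $G$ (distinct vertices $x,z,y$ with $xz,zy\in E$) with $x,y\in S$, we also have $z\in S$. The number $noc(G)$ denotes the number of $P_3$-convex subsets of $V$ (including $\emptyset$). $K_{1,n-1}$ is the complete bipartite graph with parts of sizes $1$ and $n-1$ (for $n=1$ it is the single-vertex graph). -}

module Defs where

open import Data.Nat using (ℕ; zero; suc)
open import Data.Bool using (Bool; true; false; T)
open import Data.Fin using (Fin; zero; suc; _≟_)
open import Data.Fin.Subset using (Subset)
open import Data.Fin.Subset.Properties using (_∈?_)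
open import Data.Fin.Subset using (_∈_)
open import Data.Fin.Properties using (all?)
open import Data.Vec using (Vec; []; _∷_)
open import Data.List using (List; []; _∷_; map; _++_; length; filter)
open import Data.Product using (_×_; _,_)
open import Relation.Nullary using (¬_; Dec; yes; no)
open import Relation.Nullary.Decidable using (_×-dec_; _→-dec_; ¬?)
open import Relation.Binary.PropositionalEquality using (_≡_)

record Graph (n : ℕ) : Set where
  field
    adj   : Fin n → Fin n → Bool
    sym   : ∀ u v → adj u v ≡ adj v u
    irrefl : ∀ v → adj v v ≡ false

open Graph public

E : ∀ {n} → Graph n → Fin n → Fin n → Set
E G u v = T (adj G u v)

IsP3Convex : ∀ {n} → Graph n → Subset n → Set
IsP3Convex {n} G S =
  (x z y : Fin n) → ¬ x ≡ z → ¬ z ≡ y → ¬ x ≡ y →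
  E G x z → E G z y → x ∈ S → y ∈ S → z ∈ S

T? : (b : Bool) → Dec (T b)
T? true = yes _
T? false = no (λ ())

isP3Convex? : ∀ {n} (G : Graph n) (S : Subset n) → Dec (IsP3Convex G S)
isP3Convex? {n} G S =
  all? λ x → all? λ z → all? λ y →
    ¬? (x ≟ z) →-dec (¬? (z ≟ y) →-dec (¬? (x ≟ y) →-dec
    (T? (adj G x z) →-dec (T? (adj G z y) →-dec
    ((x ∈? S) →-dec ((y ∈? S) →-dec (z ∈? S)))))))

allSubsets : (n : ℕ) → List (Subset n)
allSubsets zero = [] ∷ []
allSubsets (suc n) = map (true ∷_) (allSubsets n) ++ map (false ∷_) (allSubsets n)

noc : ∀ {n} → Graph n → ℕ
noc {n} G = length (filter (isP3Convex? G) (allSubsets n))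

-- The star K_{1,n-1} on vertex set Fin n with centre zero
-- (for n = 1 it is the single vertex graph).
starAdj : ∀ {n} → Fin n → Fin n → Bool
starAdj zero zero = false
starAdj zero (suc _) = true
starAdj (suc _) zero = true
starAdj (suc _) (suc _) = false

star : (n : ℕ) → Graph n
star n = record { adj = starAdj ; sym = s ; irrefl = i }
  where
  s : ∀ u v → starAdj u v ≡ starAdj v u
  s zero zero = _≡_.refl
  s zero (suc _) = _≡_.refl
  s (suc _) zero = _≡_.refl
  s (suc _) (suc _) = _≡_.refl
  i : ∀ v → starAdj v v ≡ false
  i zero = _≡_.refl
  i (suc _) = _≡_.refl

-- Every subset containing the centre is P₃-convex, since the centre is the middle
-- vertex of every path x–z–y in a star; this gives 2ⁿ sets. A subset avoiding the
-- centre is convex exactly when it does not contain two distinct leaves, since any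
-- two leaves are joined through the centre; this gives the n + 1 sets of at most
-- one leaf.
module Submission where

open import Defs
open import Data.Nat using (ℕ; suc; _+_; _^_)
open import Relation.Binary.PropositionalEquality using (_≡_)

open import Data.Nat using (zero)
open import Data.Nat.Properties using (+-identityʳ)
open import Data.Empty using (⊥-elim)
open import Data.Fin using (Fin; zero; suc; _≟_)
open import Data.Fin.Properties using (suc-injective)
open import Data.Fin.Subset using (Subset; inside; outside; _∈_; Empty)
open import Data.Fin.Subset.Properties using (drop-∷-Empty; nonempty?)
open import Data.Vec using ([]; _∷_; here; there)
open import Data.List using (List; []; _∷_; map; _++_; length; filter)
open import Data.List.Properties using (length-++; length-map; filter-++; filter-all; filter-none; filter-≐)
import Data.List.Relation.Unary.All as All
open import Data.Product using (_,_; proj₁; proj₂)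
open import Function using (_∘_; case_of_)
open import Level using (Level)
open import Relation.Nullary using (¬_; yes; no)
open import Relation.Nullary.Decidable using (¬?; map′)
open import Relation.Unary using (Pred; Decidable; Universal; _≐_)
open import Relation.Binary.PropositionalEquality using (refl; cong; cong₂; module ≡-Reasoning)
open ≡-Reasoning

private
  variable
    a b p q : Level
    A : Set a
    B : Set b
    n : ℕ

module _ {P : Pred A p} (P? : Decidable P) where

  length-filter-++ : ∀ xs ys →
    length (filter P? (xs ++ ys)) ≡ length (filter P? xs) + length (filter P? ys)
  length-filter-++ xs ys = begin
    length (filter P? (xs ++ ys))                 ≡⟨ cong length (filter-++ P? xs ys) ⟩
    length (filter P? xs ++ filter P? ys)         ≡⟨ length-++ (filter P? xs) ⟩
    length (filter P? xs) + length (filter P? ys) ∎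

  length-filter-map : (f : B → A) (xs : List B) →
    length (filter P? (map f xs)) ≡ length (filter (P? ∘ f) xs)
  length-filter-map f [] = refl
  length-filter-map f (x ∷ xs) with P? (f x)
  ... | yes _ = cong suc (length-filter-map f xs)
  ... | no _  = length-filter-map f xs

  length-filter-all : Universal P → ∀ xs → length (filter P? xs) ≡ length xs
  length-filter-all all xs = cong length (filter-all P? (All.universal all xs))

  length-filter-none : (∀ x → ¬ P x) → ∀ xs → length (filter P? xs) ≡ 0
  length-filter-none none xs = cong length (filter-none P? (All.universal none xs))

length-filter-≐ : {P : Pred A p} {Q : Pred A q} (P? : Decidable P) (Q? : Decidable Q) →
  P ≐ Q → ∀ xs → length (filter P? xs) ≡ length (filter Q? xs)
length-filter-≐ P? Q? P≐Q xs = cong length (filter-≐ P? Q? P≐Q xs)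

length-allSubsets : ∀ n → length (allSubsets n) ≡ 2 ^ n
length-allSubsets zero = refl
length-allSubsets (suc n) = begin
  length (map (inside ∷_) ss ++ map (outside ∷_) ss)        ≡⟨ length-++ (map (inside ∷_) ss) ⟩
  length (map (inside ∷_) ss) + length (map (outside ∷_) ss) ≡⟨ cong₂ _+_ (length-map _ ss) (length-map _ ss) ⟩
  length ss + length ss                                       ≡⟨ cong (λ m → m + m) (length-allSubsets n) ⟩
  2 ^ n + 2 ^ n                                               ≡⟨ cong (2 ^ n +_) (+-identityʳ (2 ^ n)) ⟨
  2 ^ suc n                                                   ∎
  where
  ss : List (Subset n)
  ss = allSubsets n

length-filter-allSubsets-suc : ∀ n {P : Pred (Subset (suc n)) p} (P? : Decidable P) →
  length (filter P? (allSubsets (suc n))) ≡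
    length (filter (P? ∘ (inside ∷_)) (allSubsets n)) + length (filter (P? ∘ (outside ∷_)) (allSubsets n))
length-filter-allSubsets-suc n P? = begin
  length (filter P? (map (inside ∷_) ss ++ map (outside ∷_) ss))
    ≡⟨ length-filter-++ P? (map (inside ∷_) ss) _ ⟩
  length (filter P? (map (inside ∷_) ss)) + length (filter P? (map (outside ∷_) ss))
    ≡⟨ cong₂ _+_ (length-filter-map P? (inside ∷_) ss) (length-filter-map P? (outside ∷_) ss) ⟩
  length (filter (P? ∘ (inside ∷_)) ss) + length (filter (P? ∘ (outside ∷_)) ss)
    ∎
  where
  ss : List (Subset n)
  ss = allSubsets n

empty? : Decidable (Empty {n})
empty? = ¬? ∘ nonempty?

AtMostOne : Subset n → Set
AtMostOne S = ∀ {i j} → i ∈ S → j ∈ S → i ≡ j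

Empty-outside∷ : Empty ∘ (outside ∷_) ≐ Empty {n}
Empty-outside∷ = drop-∷-Empty , λ S-empty → λ { (suc i , there i∈S) → S-empty (i , i∈S) }

AtMostOne-inside∷ : AtMostOne ∘ (inside ∷_) ≐ Empty {n}
AtMostOne-inside∷ = (λ amo (i , i∈S) → case amo here (there i∈S) of λ ())
                  , λ S-empty → λ { here here → refl
                                  ; here (there j∈S) → ⊥-elim (S-empty (_ , j∈S))
                                  ; (there i∈S) _ → ⊥-elim (S-empty (_ , i∈S)) }

AtMostOne-outside∷ : AtMostOne ∘ (outside ∷_) ≐ AtMostOne {n}
AtMostOne-outside∷ = (λ amo i∈S j∈S → suc-injective (amo (there i∈S) (there j∈S)))
                   , λ amo → λ { (there i∈S) (there j∈S) → cong suc (amo i∈S j∈S) }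

atMostOne? : Decidable (AtMostOne {n})
atMostOne? []            = yes λ ()
atMostOne? (inside ∷ S)  = map′ (proj₂ AtMostOne-inside∷) (proj₁ AtMostOne-inside∷) (empty? S)
atMostOne? (outside ∷ S) = map′ (proj₂ AtMostOne-outside∷) (proj₁ AtMostOne-outside∷) (atMostOne? S)

length-filter-Empty-allSubsets : ∀ n → length (filter empty? (allSubsets n)) ≡ 1
length-filter-Empty-allSubsets zero = refl
length-filter-Empty-allSubsets (suc n) = begin
  length (filter empty? (allSubsets (suc n)))
    ≡⟨ length-filter-allSubsets-suc n empty? ⟩
  length (filter (empty? ∘ (inside ∷_)) ss) + length (filter (empty? ∘ (outside ∷_)) ss)
    ≡⟨ cong₂ _+_ (length-filter-none _ (λ S empty → empty (zero , here)) ss)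
                 (length-filter-≐ _ empty? Empty-outside∷ ss) ⟩
  0 + length (filter empty? ss)
    ≡⟨ length-filter-Empty-allSubsets n ⟩
  1 ∎
  where
  ss : List (Subset n)
  ss = allSubsets n

length-filter-AtMostOne-allSubsets : ∀ n → length (filter atMostOne? (allSubsets n)) ≡ suc n
length-filter-AtMostOne-allSubsets zero = refl
length-filter-AtMostOne-allSubsets (suc n) = begin
  length (filter atMostOne? (allSubsets (suc n)))
    ≡⟨ length-filter-allSubsets-suc n atMostOne? ⟩
  length (filter (atMostOne? ∘ (inside ∷_)) ss) + length (filter (atMostOne? ∘ (outside ∷_)) ss)
    ≡⟨ cong₂ _+_ (length-filter-≐ _ empty? AtMostOne-inside∷ ss)
                 (length-filter-≐ _ atMostOne? AtMostOne-outside∷ ss) ⟩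
  length (filter empty? ss) + length (filter atMostOne? ss)
    ≡⟨ cong₂ _+_ (length-filter-Empty-allSubsets n) (length-filter-AtMostOne-allSubsets n) ⟩
  suc (suc n) ∎
  where
  ss : List (Subset n)
  ss = allSubsets n

star-middle≡centre : {x z y : Fin (suc n)} → ¬ x ≡ y →
  E (star (suc n)) x z → E (star (suc n)) z y → z ≡ zero
star-middle≡centre {z = zero}                    _   _ _  = refl
star-middle≡centre {x = zero} {suc _} {zero}     x≢y _ _  = ⊥-elim (x≢y refl)
star-middle≡centre {x = zero} {suc _} {suc _}    _   _ ()
star-middle≡centre {x = suc _} {suc _}           _   () _

star-convex-inside∷ : Universal (IsP3Convex (star (suc n)) ∘ (inside ∷_))
star-convex-inside∷ S x z y _ _ x≢y xz zy _ _ with star-middle≡centre x≢y xz zy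
... | refl = here

star-convex-outside∷ : IsP3Convex (star (suc n)) ∘ (outside ∷_) ≐ AtMostOne
star-convex-outside∷ = convex⇒atMostOne , atMostOne⇒convex
  where
  convex⇒atMostOne : ∀ {S} → IsP3Convex (star (suc n)) (outside ∷ S) → AtMostOne S
  convex⇒atMostOne convex {i} {j} i∈S j∈S with i ≟ j
  ... | yes i≡j = i≡j
  ... | no i≢j with convex (suc i) zero (suc j) (λ ()) (λ ()) (i≢j ∘ suc-injective) _ _ (there i∈S) (there j∈S)
  ...   | ()

  atMostOne⇒convex : ∀ {S} → AtMostOne S → IsP3Convex (star (suc n)) (outside ∷ S)
  atMostOne⇒convex amo _ _ _ _ _ x≢y _ _ (there i∈S) (there j∈S) = ⊥-elim (x≢y (cong suc (amo i∈S j∈S)))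

lemma2p6 : (n : ℕ) → noc (star (suc n)) ≡ 2 ^ n + suc n
lemma2p6 n = begin
  noc (star (suc n))
    ≡⟨ length-filter-allSubsets-suc n convex? ⟩
  length (filter (convex? ∘ (inside ∷_)) ss) + length (filter (convex? ∘ (outside ∷_)) ss)
    ≡⟨ cong₂ _+_ (length-filter-all _ star-convex-inside∷ ss)
                 (length-filter-≐ _ atMostOne? star-convex-outside∷ ss) ⟩
  length ss + length (filter atMostOne? ss)
    ≡⟨ cong₂ _+_ (length-allSubsets n) (length-filter-AtMostOne-allSubsets n) ⟩
  2 ^ n + suc n ∎
  where
  convex? : Decidable (IsP3Convex (star (suc n)))
  convex? = isP3Convex? (star (suc n))
  ss : List (Subset n)
  ss = allSubsets n
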